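{- Let $F$ be a figure with an equilibrium function $eq$ and let $\mathcal{H}_F$ be the associated set of height functions. If $h,h'\in\mathcal{H}_F$, then the pointwise minimum $\inf(h,h')$ and the pointwise maximum $\sup(h,h')$ also belong to $\mathcal{H}_F$. Consequently $(\mathcal{H}_F,\leq)$, with $\leq$ the pointwise order, is a distributive lattice, and so is the set of domino tilings of $F$ ordered by $T\le T'$ iff $h_T\le h_{T'}$.
   Context: Square grid $\Lambda$ with vertices $\mathbb{Z}^2$, unit edges, unit square cells coloured black/white as a checkerboard. A figure $F$ is a finite 4-connected union of cells (possibly with holes). $H_\infty$ is the unbounded 8-connected component of $\mathbb{R}^2\setminus F$. Every vertex all of whose incident edges lie on the boundary of $F$ (two cells of $F$ meeting only at that corner) is replaced by two copies, each adjacent to the two neighbours lying on one of these cells. $G_F=(V_F,E_F)$: vertices are corners of cells of $F$ (after duplication), arcs are both orientations of each side of each cell of $F$; $E_b(F)$: arcs whose edge lies on the boundary of $F$; others are interior. For $g:E_F\to\mathbb{Z}$ and a path $P$, $g(P)$ is the sum of $g$ over arcs of $P$; $D(h)(v,v')=h(v')-h(v)$. Spin: $sp(v,v')=1$ if moving from $v$ to $v'$ there is a white cell on the left, $-1$ otherwise. For an elementary clockwise cycle $C$, $Dis_F(C)$ = (black cells of $F$ enclosed) $-$ (white cells of $F$ enclosed). An equilibrium function is a skew-symmetric $eq:E_F\to\mathbb{Z}$ with $sp(C)+eq(C)=4Dis_F(C)$ for every elementary clockwise cycle $C$ of $G_F$. $\mathbf{t}(a)=eq(a)-sp(a)+2$,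 $\mathbf{b}(a)=eq(a)-sp(a)-2$ for interior arcs, $\mathbf{t}(a)=\mathbf{b}(a)=eq(a)+sp(a)$ for $a\in E_b(F)$. Fix $w_0\in V_F$ on the boundary of $H_\infty$. $\mathcal{H}_F$ is the set of $h:V_F\to\mathbb{Z}$ with $h(w_0)=0$ and $D(h)(a)\in\{\mathbf{b}(a),\mathbf{t}(a)\}$ for all $a\in E_F$. For a domino tiling $T$ of $F$ (dominoes = two cells sharing an edge, the central axis; disjoint interiors, union $F$), $\chi_T(a)=1$ iff the edge of $a$ is a central axis of a domino of $T$, $g_T(a)=eq(a)-sp(a)+2sp(a)(1-2\chi_T(a))$, and $h_T$ is the unique function with $h_T(w_0)=0$, $D(h_T)=g_T$; the map $T\mapsto h_T$ is a bijection from tilings of $F$ onto $\mathcal{H}_F$. -}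

module Defs where

open import Data.Bool using (Bool; true; false; T; _∧_; _∨_; not; if_then_else_)
open import Data.Nat using (ℕ; _%_; _≡ᵇ_)
open import Data.Integer using (ℤ; +_; _+_; _-_; _*_; -_; ∣_∣; _≤_; _<_; _⊓_; _⊔_; _≟_; 0ℤ; 1ℤ; -1ℤ; _≤ᵇ_)
open import Data.Product using (Σ; _×_; _,_; proj₁; proj₂; ∃)
open import Data.Sum using (_⊎_)
open import Data.List using (List; []; _∷_; map; length; filter; foldr)
open import Data.Bool.ListAction using (any)
open import Data.List.Relation.Unary.Unique.Propositional using (Unique)
open import Data.Unit using (⊤)
open import Relation.Nullary using (¬_)
open import Relation.Nullary.Decidable using (does)
open import Relation.Binary.PropositionalEquality using (_≡_; _≢_)
open import Relation.Binary.Lattice.Structures using (IsDistributiveLattice)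

Pt : Set
Pt = ℤ × ℤ

-- A unit cell is named by its lower-left corner: (x , y) is [x,x+1]×[y,y+1].
Cell : Set
Cell = ℤ × ℤ

_==ℤ_ : ℤ → ℤ → Bool
a ==ℤ b = does (a ≟ b)

_==c_ : Cell → Cell → Bool
(a , b) ==c (c , d) = (a ==ℤ c) ∧ (b ==ℤ d)

isWhite : Cell → Bool
isWhite (x , y) = (∣ x + y ∣ % 2) ≡ᵇ 1

Figure : Set
Figure = List Cell

inF : Figure → Cell → Bool
inF F c = any (λ d → d ==c c) F

Adj4 : Cell → Cell → Set
Adj4 (x , y) (x' , y') =
  ((x' ≡ x + 1ℤ) × (y' ≡ y)) ⊎ ((x' ≡ x - 1ℤ) × (y' ≡ y)) ⊎
  ((x' ≡ x) × (y' ≡ y + 1ℤ)) ⊎ ((x' ≡ x) × (y' ≡ y - 1ℤ))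

Near : ℤ → ℤ → Set
Near a b = (b ≡ a) ⊎ (b ≡ a + 1ℤ) ⊎ (b ≡ a - 1ℤ)

Adj8 : Cell → Cell → Set
Adj8 (x , y) (x' , y') = Near x x' × Near y y' × ((x , y) ≢ (x' , y'))

data Conn4 (F : Figure) : Cell → Cell → Set where
  here : ∀ {c} → T (inF F c) → Conn4 F c c
  step : ∀ {c d e} → T (inF F c) → Adj4 c d → Conn4 F d e → Conn4 F c e

IsFigure : Figure → Set
IsFigure F = Unique F × (∀ c c' → T (inF F c) → T (inF F c') → Conn4 F c c')

data Dir : Set where
  E N W S : Dir

opp : Dir → Dir
opp E = W
opp N = S
opp W = E
opp S = N

move : Pt → Dir → Pt
move (x , y) E = (x + 1ℤ , y)
move (x , y) N = (x , y + 1ℤ)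
move (x , y) W = (x - 1ℤ , y)
move (x , y) S = (x , y - 1ℤ)

Arc : Set
Arc = Pt × Dir

src₀ tgt₀ : Arc → Pt
src₀ (p , d) = p
tgt₀ (p , d) = move p d

rev : Arc → Arc
rev (p , d) = (move p d , opp d)

leftCell rightCell : Arc → Cell
leftCell ((x , y) , E) = (x , y)
leftCell ((x , y) , N) = (x - 1ℤ , y)
leftCell ((x , y) , W) = (x - 1ℤ , y - 1ℤ)
leftCell ((x , y) , S) = (x , y - 1ℤ)
rightCell ((x , y) , E) = (x , y - 1ℤ)
rightCell ((x , y) , N) = (x , y)
rightCell ((x , y) , W) = (x - 1ℤ , y)
rightCell ((x , y) , S) = (x - 1ℤ , y - 1ℤ)

isArc : Figure → Arc → Bool
isArc F a = inF F (leftCell a) ∨ inF F (rightCell a)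

isInterior : Figure → Arc → Bool
isInterior F a = inF F (leftCell a) ∧ inF F (rightCell a)

SWc SEc NWc NEc : Pt → Cell
SWc (x , y) = (x - 1ℤ , y - 1ℤ)
SEc (x , y) = (x , y - 1ℤ)
NWc (x , y) = (x - 1ℤ , y)
NEc (x , y) = (x , y)

-- Pinch point: two cells of F meet only at that corner (all four incident
-- edges on the boundary of F).  Such a point is duplicated.
isPinch : Figure → Pt → Bool
isPinch F p =
  (inF F (SWc p) ∧ inF F (NEc p) ∧ not (inF F (SEc p)) ∧ not (inF F (NWc p))) ∨
  (inF F (NWc p) ∧ inF F (SEc p) ∧ not (inF F (SWc p)) ∧ not (inF F (NEc p)))

-- Non-pinch points only use the
-- tag false; at a pinch point the copy false belongs to the western cell of F
-- and the copy true to the eastern cell of F.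
Vtx : Set
Vtx = Pt × Bool

isCorner : Figure → Pt → Bool
isCorner F p = inF F (SWc p) ∨ inF F (SEc p) ∨ inF F (NWc p) ∨ inF F (NEc p)

isVertex : Figure → Vtx → Bool
isVertex F (p , false) = isCorner F p
isVertex F (p , true)  = isPinch F p

copyOn : Figure → Pt → Cell → Vtx
copyOn F p c = (p , (isPinch F p ∧ (proj₁ c ==ℤ proj₁ p)))

arcCell : Figure → Arc → Cell
arcCell F a = if inF F (leftCell a) then leftCell a else rightCell a

src tgt : Figure → Arc → Vtx
src F a = copyOn F (src₀ a) (arcCell F a)
tgt F a = copyOn F (tgt₀ a) (arcCell F a)

sp : Arc → ℤ
sp a = if isWhite (leftCell a) then 1ℤ else -1ℤ

sumℤ : List ℤ → ℤ
sumℤ = foldr _+_ 0ℤ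

pathSum : (Arc → ℤ) → List Arc → ℤ
pathSum g P = sumℤ (map g P)

Walk : Figure → Vtx → Vtx → List Arc → Set
Walk F v w []      = v ≡ w
Walk F v w (a ∷ P) = T (isArc F a) × (src F a ≡ v) × Walk F (tgt F a) w P

-- Twice the signed (shoelace) area enclosed by a closed walk.
area2 : List Arc → ℤ
area2 P = sumℤ (map (λ a → proj₁ (src₀ a) * proj₂ (tgt₀ a) - proj₁ (tgt₀ a) * proj₂ (src₀ a)) P)

-- Winding number of a closed walk around the centre of cell c
-- (counter-clockwise positive), via signed crossings of the rightward ray.
windArc : Cell → Arc → ℤ
windArc (cx , cy) ((x , y) , N) = if (cx + 1ℤ ≤ᵇ x) ∧ (y ==ℤ cy) then 1ℤ else 0ℤ
windArc (cx , cy) ((x , y) , S) = if (cx + 1ℤ ≤ᵇ x) ∧ (y ==ℤ (cy + 1ℤ)) then -1ℤ else 0ℤ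
windArc c (p , E) = 0ℤ
windArc c (p , W) = 0ℤ

winding : List Arc → Cell → ℤ
winding C c = sumℤ (map (windArc c) C)

encloses : List Arc → Cell → Bool
encloses C c = not (winding C c ==ℤ 0ℤ)

ElemClockwiseCycle : Figure → List Arc → Set
ElemClockwiseCycle F C =
  (Σ Vtx λ v → Walk F v v C) × Unique (map (src F) C) × (area2 C < 0ℤ)

Dis : Figure → List Arc → ℤ
Dis F C = sumℤ (map (λ c → if encloses C c then (if isWhite c then -1ℤ else 1ℤ) else 0ℤ) F)

-- Equilibrium function (values off E_F are irrelevant).
IsEquilibrium : Figure → (Arc → ℤ) → Set
IsEquilibrium F eq =
  (∀ a → T (isArc F a) → eq (rev a) ≡ - eq a) ×
  (∀ C → ElemClockwiseCycle F C → pathSum sp C + pathSum eq C ≡ (+ 4) * Dis F C)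

data Conn8c (F : Figure) : Cell → Cell → Set where
  here : ∀ {c} → T (not (inF F c)) → Conn8c F c c
  step : ∀ {c d e} → T (not (inF F c)) → Adj8 c d → Conn8c F d e → Conn8c F c e

InHinf : Figure → Cell → Set
InHinf F c = Σ Cell λ far → (∀ d → T (inF F d) → proj₁ d < proj₁ far) × Conn8c F far c

OnBoundaryHinf : Figure → Vtx → Set
OnBoundaryHinf F w0 =
  T (isVertex F w0) ×
  Σ Cell λ c → InHinf F c ×
    ((c ≡ SWc (proj₁ w0)) ⊎ (c ≡ SEc (proj₁ w0)) ⊎ (c ≡ NWc (proj₁ w0)) ⊎ (c ≡ NEc (proj₁ w0)))

D : (Vtx → ℤ) → Figure → Arc → ℤ
D h F a = h (tgt F a) - h (src F a)

tt bb : Figure → (Arc → ℤ) → Arc → ℤ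
tt F eq a = if isInterior F a then eq a - sp a + (+ 2) else eq a + sp a
bb F eq a = if isInterior F a then eq a - sp a - (+ 2) else eq a + sp a

-- h ∈ H_F  (h is only relevant on V_F).
InH : Figure → (Arc → ℤ) → Vtx → (Vtx → ℤ) → Set
InH F eq w0 h =
  (h w0 ≡ 0ℤ) ×
  (∀ a → T (isArc F a) → (D h F a ≡ bb F eq a) ⊎ (D h F a ≡ tt F eq a))

HF : Figure → (Arc → ℤ) → Vtx → Set
HF F eq w0 = Σ (Vtx → ℤ) (InH F eq w0)

_≈H_ : ∀ {F eq w0} → HF F eq w0 → HF F eq w0 → Set
_≈H_ {F} (h , _) (h' , _) = ∀ v → T (isVertex F v) → h v ≡ h' v

_≤H_ : ∀ {F eq w0} → HF F eq w0 → HF F eq w0 → Set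
_≤H_ {F} (h , _) (h' , _) = ∀ v → T (isVertex F v) → h v ≤ h' v

-- A domino: (c , true) = cells c and c+(1,0) (horizontal);
--           (c , false) = cells c and c+(0,1) (vertical).
Domino : Set
Domino = Cell × Bool

cell₁ cell₂ : Domino → Cell
cell₁ (c , _) = c
cell₂ ((x , y) , true)  = (x + 1ℤ , y)
cell₂ ((x , y) , false) = (x , y + 1ℤ)

covers : Domino → Cell → Bool
covers d c = (cell₁ d ==c c) ∨ (cell₂ d ==c c)

countCovers : List Domino → Cell → ℕ
countCovers [] c = 0
countCovers (d ∷ ds) c = if covers d c then Data.Nat.suc (countCovers ds c) else countCovers ds c

IsTiling : Figure → List Domino → Set
IsTiling F Tl =
  (∀ d → T (any (λ d' → (cell₁ d' ==c cell₁ d) ∧ (cell₂ d' ==c cell₂ d)) Tl) →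
     T (inF F (cell₁ d)) × T (inF F (cell₂ d))) ×
  (∀ c → T (inF F c) → countCovers Tl c ≡ 1)

Tiling : Figure → Set
Tiling F = Σ (List Domino) (IsTiling F)

-- Undirected edge of an arc: (lower/left endpoint , horizontal?).
edgeOf : Arc → Pt × Bool
edgeOf (p , E) = (p , true)
edgeOf (p , W) = (move p W , true)
edgeOf (p , N) = (p , false)
edgeOf (p , S) = (move p S , false)

axis : Domino → Pt × Bool
axis ((x , y) , true)  = ((x + 1ℤ , y) , false)
axis ((x , y) , false) = ((x , y + 1ℤ) , true)

_==e_ : Pt × Bool → Pt × Bool → Bool
(p , b) ==e (q , b') = (p ==c q) ∧ does (Data.Bool._≟_ b b')

χ : List Domino → Arc → ℤ
χ Tl a = if any (λ d → axis d ==e edgeOf a) Tl then 1ℤ else 0ℤ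

g : (Arc → ℤ) → List Domino → Arc → ℤ
g eq Tl a = eq a - sp a + (+ 2) * sp a * (1ℤ - (+ 2) * χ Tl a)

IsHeightOf : Figure → (Arc → ℤ) → Vtx → List Domino → (Vtx → ℤ) → Set
IsHeightOf F eq w0 Tl h = (h w0 ≡ 0ℤ) × (∀ a → T (isArc F a) → D h F a ≡ g eq Tl a)

-- The (previously established) bijection T ↦ h_T: every tiling has a height
-- function, and every element of H_F is the height function of some tiling.
HeightBijection : Figure → (Arc → ℤ) → Vtx → Set
HeightBijection F eq w0 =
  (∀ (Tl : Tiling F) → Σ (Vtx → ℤ) (IsHeightOf F eq w0 (proj₁ Tl))) ×
  (∀ h → InH F eq w0 h → Σ (Tiling F) λ Tl → IsHeightOf F eq w0 (proj₁ Tl) h)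

_≤Tl_ : ∀ {F eq w0} → Tiling F → Tiling F → Set
_≤Tl_ {F} {eq} {w0} (Tl , _) (Tl' , _) =
  ∀ h h' → IsHeightOf F eq w0 Tl h → IsHeightOf F eq w0 Tl' h' →
  ∀ v → T (isVertex F v) → h v ≤ h' v

_≈Tl_ : ∀ {F eq w0} → Tiling F → Tiling F → Set
_≈Tl_ {F} {eq} {w0} (Tl , _) (Tl' , _) =
  ∀ h h' → IsHeightOf F eq w0 Tl h → IsHeightOf F eq w0 Tl' h' →
  ∀ v → T (isVertex F v) → h v ≡ h' v

HDistributiveLattice : Figure → (Arc → ℤ) → Vtx → Set
HDistributiveLattice F eq w0 =
  Σ (HF F eq w0 → HF F eq w0 → HF F eq w0) λ _∨H_ →
  Σ (HF F eq w0 → HF F eq w0 → HF F eq w0) λ _∧H_ →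
  IsDistributiveLattice (_≈H_ {F} {eq} {w0}) (_≤H_ {F} {eq} {w0}) _∨H_ _∧H_

TilingDistributiveLattice : Figure → (Arc → ℤ) → Vtx → Set
TilingDistributiveLattice F eq w0 =
  Σ (Tiling F → Tiling F → Tiling F) λ _∨T_ →
  Σ (Tiling F → Tiling F → Tiling F) λ _∧T_ →
  IsDistributiveLattice (_≈Tl_ {F} {eq} {w0}) (_≤Tl_ {F} {eq} {w0}) _∨T_ _∧T_

-- Along an arc a the increment of a height function is bb a or tt a, where tt a − bb a is 4 on
-- interior arcs and 0 on boundary arcs. Since G_F is connected and every height vanishes at w0, any
-- two heights h, h' are congruent modulo 4 at every vertex. On an arc from u to w, if the increments
-- of h and h' both lie in {b, b + 4}, the increment of min(h, h') is ≡ b modulo 4 and lies in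
-- [b, b + 4], hence is b or b + 4; likewise for max. So H_F is a sublattice of the distributive
-- lattice of integer functions on V_F, and the bijection T ↦ h_T carries this structure to tilings
-- (heights of a tiling are unique, again by connectedness of G_F).

module Submission where

open import Defs
open import Algebra.Consequences.Base using (sel⇒idem)
open import Algebra.Core using (Op₂)
open import Algebra.Definitions using (Selective)
open import Data.Bool using (true; false; T)
open import Data.Bool.ListAction using (any)
open import Data.Bool.Properties using (T-≡; T-∨; T-∧; ∧-zeroʳ; ∧-identityʳ)
open import Data.Empty using (⊥-elim)
open import Data.Integer using (ℤ; +_; _+_; _-_; _*_; -_; _≤_; _⊓_; _⊔_; 0ℤ; 1ℤ; -1ℤ; _≟_; _≤?_)
open import Data.Integer.Divisibility.Signed
  using (_∣_; divides; ∣m∣n⇒∣m+n; ∣m∣n⇒∣m-n; ∣m⇒∣-m; 0∣⇒≡0)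
open import Data.Integer.Properties
open import Data.Integer.Tactic.RingSolver using (solve-∀)
open import Data.List.Membership.Propositional using (find; lose)
open import Data.List.Relation.Unary.Any.Properties using (any⁺; any⁻)
open import Data.Nat using (ℕ)
open import Data.Product using (_×_; _,_; proj₁; proj₂)
open import Data.Sum using (_⊎_; inj₁; inj₂)
import Data.Sum
open import Function.Base using (id)
open import Function.Bundles using (Equivalence; _⇔_; mk⇔)
open import Level using (0ℓ)
open import Relation.Binary.Core using (Rel; _Preserves₂_⟶_⟶_)
open import Relation.Binary.Construct.Closure.Equivalence using (EqClosure; symmetric)
open import Relation.Binary.Construct.Closure.ReflexiveTransitive using (ε; _◅_; _◅◅_)
open import Relation.Binary.Construct.Closure.Symmetric using (fwd; bwd)
open import Relation.Binary.Lattice.Structures using (IsDistributiveLattice)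
open import Relation.Binary.PropositionalEquality
open import Relation.Nullary using (Dec; yes; no; does; _because_)
open import Relation.Nullary.Reflects using (invert)
open import Relation.Nullary.Decidable using (dec-true; dec-false)

open Equivalence using (to; from)

i+j-i≡j : ∀ i j → i + j - i ≡ j
i+j-i≡j = solve-∀

i≡j+[i-j] : ∀ i j → i ≡ j + (i - j)
i≡j+[i-j] = solve-∀

i-j≡k⇒i≡j+k : ∀ {i j k} → i - j ≡ k → i ≡ j + k
i-j≡k⇒i≡j+k {i} {j} refl = i≡j+[i-j] i j

i≤i+[+m] : ∀ i m → i ≤ i + + m
i≤i+[+m] i m = subst (i ≤_) (+-comm (+ m) i) (i≤j⇒i≤k+j (+ m) ≤-refl)

infix 4 _≡_[mod_] _∈⟨_,_⟩

-- A record rather than a synonym for  + m ∣ x - y , so that x and y remain inferable.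
record _≡_[mod_] (x y : ℤ) (m : ℕ) : Set where
  constructor ≡-mod
  field ∣-diff : + m ∣ x - y

_∈⟨_,_⟩ : ℤ → ℤ → ℤ → Set
e ∈⟨ b , c ⟩ = e ≡ b ⊎ e ≡ c

module _ {m : ℕ} where

  ≡-mod-reflexive : ∀ {x y} → x ≡ y → x ≡ y [mod m ]
  ≡-mod-reflexive {x} refl = ≡-mod (divides 0ℤ (i≡j⇒i-j≡0 {x} refl))

  ≡-mod-sym : ∀ {x y} → x ≡ y [mod m ] → y ≡ x [mod m ]
  ≡-mod-sym {x} {y} (≡-mod x≡y) = ≡-mod (subst (+ m ∣_) (neg-minus x y) (∣m⇒∣-m x≡y))
    where
    neg-minus : ∀ x y → - (x - y) ≡ y - x
    neg-minus = solve-∀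

  ≡-mod-trans : ∀ {x y z} → x ≡ y [mod m ] → y ≡ z [mod m ] → x ≡ z [mod m ]
  ≡-mod-trans {x} {y} {z} (≡-mod x≡y) (≡-mod y≡z) =
    ≡-mod (subst (+ m ∣_) (+-minus-telescope x y z) (∣m∣n⇒∣m+n x≡y y≡z))

  +-cong-mod : ∀ {x x' y y'} → x ≡ x' [mod m ] → y ≡ y' [mod m ] → x + y ≡ x' + y' [mod m ]
  +-cong-mod {x} {x'} {y} {y'} (≡-mod p) (≡-mod q) =
    ≡-mod (subst (+ m ∣_) (regroup x x' y y') (∣m∣n⇒∣m+n p q))
    where
    regroup : ∀ x x' y y' → (x - x') + (y - y') ≡ (x + y) - (x' + y')
    regroup = solve-∀

  −-cong-mod : ∀ {x x' y y'} → x ≡ x' [mod m ] → y ≡ y' [mod m ] → x - y ≡ x' - y' [mod m ]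
  −-cong-mod {x} {x'} {y} {y'} (≡-mod p) (≡-mod q) =
    ≡-mod (subst (+ m ∣_) (regroup x x' y y') (∣m∣n⇒∣m-n p q))
    where
    regroup : ∀ x x' y y' → (x - x') - (y - y') ≡ (x - y) - (x' - y')
    regroup = solve-∀

  sel-cong-mod : ∀ {_∙_ : Op₂ ℤ} → Selective _≡_ _∙_ →
    ∀ {x y z} → x ≡ z [mod m ] → y ≡ z [mod m ] → x ∙ y ≡ z [mod m ]
  sel-cong-mod ∙-sel {x} {y} p q with ∙-sel x y
  ... | inj₁ x∙y≡x rewrite x∙y≡x = p
  ... | inj₂ x∙y≡y rewrite x∙y≡y = q

  ∈⟨,+⟩⇒≡-mod : ∀ {e b} → e ∈⟨ b , b + + m ⟩ → e ≡ b [mod m ]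
  ∈⟨,+⟩⇒≡-mod (inj₁ e≡b) = ≡-mod-reflexive e≡b
  ∈⟨,+⟩⇒≡-mod {b = b} (inj₂ refl) =
    ≡-mod (divides 1ℤ (trans (i+j-i≡j b (+ m)) (sym (*-identityˡ (+ m)))))

  ≡-mod-shift : ∀ {x y e} → x - y ≡ e [mod m ] → x ≡ y + e [mod m ]
  ≡-mod-shift {x} {y} {e} (≡-mod p) = ≡-mod (subst (+ m ∣_) (regroup x y e) p)
    where
    regroup : ∀ x y e → (x - y) - e ≡ x - (y + e)
    regroup = solve-∀

  ∈⟨,+⟩⇒bounds : ∀ {u w b} → w - u ∈⟨ b , b + + m ⟩ → u + b ≤ w × w ≤ u + (b + + m)
  ∈⟨,+⟩⇒bounds {u} {w} {b} (inj₁ w-u≡b) with refl ← i-j≡k⇒i≡j+k {w} {u} w-u≡b =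
    ≤-refl , +-monoʳ-≤ u (i≤i+[+m] b m)
  ∈⟨,+⟩⇒bounds {u} {w} {b} (inj₂ w-u≡b+m) with refl ← i-j≡k⇒i≡j+k {w} {u} w-u≡b+m =
    +-monoʳ-≤ u (i≤i+[+m] b m) , ≤-refl

  ∣-bounded : ∀ {d} → + m ∣ d → 0ℤ ≤ d → d ≤ + m → d ≡ 0ℤ ⊎ d ≡ + m
  ∣-bounded {d} (divides q refl) 0≤d d≤m with q ≤? 0ℤ
  ... | yes q≤0 = inj₁ (≤-antisym (*-monoʳ-≤-nonNeg (+ m) q≤0) 0≤d)
  ... | no q≰0 = inj₂ (≤-antisym d≤m (begin
    + m        ≡⟨ *-identityˡ (+ m) ⟨
    1ℤ * + m   ≤⟨ *-monoʳ-≤-nonNeg (+ m) (i<j⇒suc[i]≤j (≰⇒> q≰0)) ⟩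
    q * + m    ∎))
    where open ≤-Reasoning

  ≡-mod-between : ∀ {d b} → d ≡ b [mod m ] → b ≤ d → d ≤ b + + m → d ∈⟨ b , b + + m ⟩
  ≡-mod-between {d} {b} (≡-mod d≡b) b≤d d≤b+m
    with ∣-bounded d≡b (i≤j⇒0≤j-i b≤d) (≤-trans (+-monoˡ-≤ (- b) d≤b+m) (≤-reflexive (i+j-i≡j b (+ m))))
  ... | inj₁ d-b≡0 = inj₁ (i-j≡0⇒i≡j d b d-b≡0)
  ... | inj₂ d-b≡m = inj₂ (i-j≡k⇒i≡j+k d-b≡m)

≡-mod-0⇒≡ : ∀ {x y} → x ≡ y [mod 0 ] → x ≡ y
≡-mod-0⇒≡ {x} {y} (≡-mod 0∣x-y) = i-j≡0⇒i≡j x y (0∣⇒≡0 0∣x-y)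

record IsTranslationEquivariantSelection (_∙_ : Op₂ ℤ) : Set where
  field
    ∙-sel  : Selective _≡_ _∙_
    ∙-mono : _∙_ Preserves₂ _≤_ ⟶ _≤_ ⟶ _≤_
    ∙-+    : ∀ b x y → (x + b) ∙ (y + b) ≡ (x ∙ y) + b

⊓-isTranslationEquivariantSelection : IsTranslationEquivariantSelection _⊓_
⊓-isTranslationEquivariantSelection = record
  { ∙-sel  = ⊓-sel
  ; ∙-mono = ⊓-mono-≤
  ; ∙-+    = λ b x y → sym (mono-≤-distrib-⊓ (+-monoˡ-≤ b) x y)
  }

⊔-isTranslationEquivariantSelection : IsTranslationEquivariantSelection _⊔_
⊔-isTranslationEquivariantSelection = record
  { ∙-sel  = ⊔-sel
  ; ∙-mono = ⊔-mono-≤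
  ; ∙-+    = λ b x y → sym (mono-≤-distrib-⊔ (+-monoˡ-≤ b) x y)
  }

module TranslationEquivariantSelection {_∙_ : Op₂ ℤ} (isTES : IsTranslationEquivariantSelection _∙_) where

  open IsTranslationEquivariantSelection isTES public

  ∙-+-minus : ∀ b x y → ((x + b) ∙ (y + b)) - (x ∙ y) ≡ b
  ∙-+-minus b x y = trans (cong (_- (x ∙ y)) (∙-+ b x y)) (i+j-i≡j (x ∙ y) b)

  ∙-translate : ∀ {u u' w w' b} → w - u ≡ b → w' - u' ≡ b → (w ∙ w') - (u ∙ u') ≡ b
  ∙-translate {u} {u'} {w} {w'} {b} p q =
    trans (cong₂ (λ x y → (x ∙ y) - (u ∙ u')) (i-j≡k⇒i≡j+k p) (i-j≡k⇒i≡j+k q)) (∙-+-minus b u u')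

  ∙-step : ∀ {m u u' w w' b} → u ≡ u' [mod m ] →
    w - u ∈⟨ b , b + + m ⟩ → w' - u' ∈⟨ b , b + + m ⟩ → (w ∙ w') - (u ∙ u') ∈⟨ b , b + + m ⟩
  ∙-step {m} {u} {u'} {w} {w'} {b} u≡u' r r' = ≡-mod-between congruent lower upper
    where
    open ≤-Reasoning
    w≡u+b : w ≡ u + b [mod m ]
    w≡u+b = ≡-mod-shift (∈⟨,+⟩⇒≡-mod r)
    w'≡u+b : w' ≡ u + b [mod m ]
    w'≡u+b = ≡-mod-trans (≡-mod-shift (∈⟨,+⟩⇒≡-mod r'))
                         (+-cong-mod (≡-mod-sym u≡u') (≡-mod-reflexive refl))
    congruent : (w ∙ w') - (u ∙ u') ≡ b [mod m ]
    congruent = ≡-mod-trans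
      (−-cong-mod (sel-cong-mod ∙-sel w≡u+b w'≡u+b)
                  (sel-cong-mod ∙-sel (≡-mod-reflexive refl) (≡-mod-sym u≡u')))
      (≡-mod-reflexive (i+j-i≡j u b))
    w-bounds : u + b ≤ w × w ≤ u + (b + + m)
    w-bounds = ∈⟨,+⟩⇒bounds r
    w'-bounds : u' + b ≤ w' × w' ≤ u' + (b + + m)
    w'-bounds = ∈⟨,+⟩⇒bounds r'
    lower : b ≤ (w ∙ w') - (u ∙ u')
    lower = begin
      b                                ≡⟨ ∙-+-minus b u u' ⟨
      ((u + b) ∙ (u' + b)) - (u ∙ u')  ≤⟨ +-monoˡ-≤ (- (u ∙ u')) (∙-mono (proj₁ w-bounds) (proj₁ w'-bounds)) ⟩
      (w ∙ w') - (u ∙ u')              ∎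
    upper : (w ∙ w') - (u ∙ u') ≤ b + + m
    upper = begin
      (w ∙ w') - (u ∙ u')
        ≤⟨ +-monoˡ-≤ (- (u ∙ u')) (∙-mono (proj₂ w-bounds) (proj₂ w'-bounds)) ⟩
      ((u + (b + + m)) ∙ (u' + (b + + m))) - (u ∙ u')
        ≡⟨ ∙-+-minus (b + + m) u u' ⟩
      b + + m
        ∎

module _ {A I : Set} {_≈_ _⊑_ : Rel A 0ℓ} {_∨_ _∧_ : Op₂ A}
  (V : I → Set) (φ : A → I → ℤ)
  (≈⇔ : ∀ {x y} → x ≈ y ⇔ (∀ i → V i → φ x i ≡ φ y i))
  (⊑⇔ : ∀ {x y} → x ⊑ y ⇔ (∀ i → V i → φ x i ≤ φ y i))
  (φ-∨ : ∀ x y i → V i → φ (x ∨ y) i ≡ φ x i ⊔ φ y i)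
  (φ-∧ : ∀ x y i → V i → φ (x ∧ y) i ≡ φ x i ⊓ φ y i)
  where

  pointwise-isDistributiveLattice : IsDistributiveLattice _≈_ _⊑_ _∨_ _∧_
  pointwise-isDistributiveLattice = record
    { isLattice = record
      { isPartialOrder = record
        { isPreorder = record
          { isEquivalence = record
            { refl  = from ≈⇔ λ _ _ → refl
            ; sym   = λ x≈y → from ≈⇔ λ i v → sym (to ≈⇔ x≈y i v)
            ; trans = λ x≈y y≈z → from ≈⇔ λ i v → trans (to ≈⇔ x≈y i v) (to ≈⇔ y≈z i v)
            }
          ; reflexive = λ x≈y → from ⊑⇔ λ i v → ≤-reflexive (to ≈⇔ x≈y i v)
          ; trans     = λ x⊑y y⊑z → from ⊑⇔ λ i v → ≤-trans (to ⊑⇔ x⊑y i v) (to ⊑⇔ y⊑z i v)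
          }
        ; antisym = λ x⊑y y⊑x → from ≈⇔ λ i v → ≤-antisym (to ⊑⇔ x⊑y i v) (to ⊑⇔ y⊑x i v)
        }
      ; supremum = λ x y →
          (from ⊑⇔ λ i v → subst (φ x i ≤_) (sym (φ-∨ x y i v)) (i≤i⊔j _ _)) ,
          (from ⊑⇔ λ i v → subst (φ y i ≤_) (sym (φ-∨ x y i v)) (i≤j⊔i _ _)) ,
          λ z x⊑z y⊑z → from ⊑⇔ λ i v →
            subst (_≤ φ z i) (sym (φ-∨ x y i v)) (⊔-lub (to ⊑⇔ x⊑z i v) (to ⊑⇔ y⊑z i v))
      ; infimum = λ x y →
          (from ⊑⇔ λ i v → subst (_≤ φ x i) (sym (φ-∧ x y i v)) (i⊓j≤i _ _)) ,
          (from ⊑⇔ λ i v → subst (_≤ φ y i) (sym (φ-∧ x y i v)) (i⊓j≤j _ _)) ,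
          λ z z⊑x z⊑y → from ⊑⇔ λ i v →
            subst (φ z i ≤_) (sym (φ-∧ x y i v)) (⊓-glb (to ⊑⇔ z⊑x i v) (to ⊑⇔ z⊑y i v))
      }
    ; ∧-distribˡ-∨ = λ x y z → from ≈⇔ λ i v → begin
        φ (x ∧ (y ∨ z)) i                   ≡⟨ φ-∧ x (y ∨ z) i v ⟩
        φ x i ⊓ φ (y ∨ z) i                 ≡⟨ cong (φ x i ⊓_) (φ-∨ y z i v) ⟩
        φ x i ⊓ (φ y i ⊔ φ z i)             ≡⟨ ⊓-distribˡ-⊔ (φ x i) (φ y i) (φ z i) ⟩
        (φ x i ⊓ φ y i) ⊔ (φ x i ⊓ φ z i)   ≡⟨ cong₂ _⊔_ (φ-∧ x y i v) (φ-∧ x z i v) ⟨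
        φ (x ∧ y) i ⊔ φ (x ∧ z) i           ≡⟨ φ-∨ (x ∧ y) (x ∧ z) i v ⟨
        φ ((x ∧ y) ∨ (x ∧ z)) i             ∎
    }
    where open ≡-Reasoning

i-1+1≡i : ∀ i → i - 1ℤ + 1ℤ ≡ i
i-1+1≡i = solve-∀

i+1-1≡i : ∀ i → i + 1ℤ - 1ℤ ≡ i
i+1-1≡i = solve-∀

==ℤ-refl : ∀ x → (x ==ℤ x) ≡ true
==ℤ-refl x = dec-true (x ≟ x) refl

i-1==ℤi : ∀ x → ((x - 1ℤ) ==ℤ x) ≡ false
i-1==ℤi x = dec-false (x - 1ℤ ≟ x) λ e → i≢suc[i] (trans e (sym (1+[i-1]≡i x)))
  where
  1+[i-1]≡i : ∀ i → 1ℤ + (i - 1ℤ) ≡ i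
  1+[i-1]≡i = solve-∀

does-sound : ∀ {A : Set} (a? : Dec A) → T (does a?) → A
does-sound (true because [a]) _ = invert [a]

==c-sound : ∀ {c c'} → T (c ==c c') → c ≡ c'
==c-sound {x , y} {x' , y'} c==c' with to T-∧ c==c'
... | x==x' , y==y' = cong₂ _,_ (does-sound (x ≟ x') x==x') (does-sound (y ≟ y') y==y')

==c-refl : ∀ c → T (c ==c c)
==c-refl (x , y) rewrite ==ℤ-refl x | ==ℤ-refl y = _

==e-sound : ∀ {e e'} → T (e ==e e') → e ≡ e'
==e-sound {p , b} {q , b'} e==e' with to T-∧ e==e'
... | p==q , b==b' = cong₂ _,_ (==c-sound p==q) (does-sound (b Data.Bool.≟ b') b==b')

data ArcOf (F : Figure) : Rel Vtx 0ℓ where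
  arc : ∀ a → T (isArc F a) → ArcOf F (src F a) (tgt F a)

Connected : Figure → Rel Vtx 0ℓ
Connected F = EqClosure (ArcOf F)

data Corner : Cell → Pt → Set where
  sw : ∀ {x y} → Corner (x , y) (x , y)
  se : ∀ {x y} → Corner (x , y) (x + 1ℤ , y)
  ne : ∀ {x y} → Corner (x , y) (x + 1ℤ , y + 1ℤ)
  nw : ∀ {x y} → Corner (x , y) (x , y + 1ℤ)

se-of-west : ∀ x y → Corner (x - 1ℤ , y) (x , y)
se-of-west x y = subst (λ z → Corner (x - 1ℤ , y) (z , y)) (i-1+1≡i x) se

ne-of-southwest : ∀ x y → Corner (x - 1ℤ , y - 1ℤ) (x , y)
ne-of-southwest x y = subst₂ (λ z w → Corner (x - 1ℤ , y - 1ℤ) (z , w)) (i-1+1≡i x) (i-1+1≡i y) ne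

nw-of-south : ∀ x y → Corner (x , y - 1ℤ) (x , y)
nw-of-south x y = subst (λ w → Corner (x , y - 1ℤ) (x , w)) (i-1+1≡i y) nw

record CellCorner (F : Figure) (v : Vtx) : Set where
  constructor cellCorner
  field
    {cell}   : Cell
    {corner} : Pt
    cell∈F   : T (inF F cell)
    cornerOf : Corner cell corner
    copyOf   : v ≡ copyOn F corner cell

module _ (F : Figure) where

  private
    _~_ = Connected F

  arcCell-left : ∀ a → T (inF F (leftCell a)) → arcCell F a ≡ leftCell a
  arcCell-left a l∈F rewrite to T-≡ l∈F = refl

  arc-on-left : ∀ a {c p q} → leftCell a ≡ c → src₀ a ≡ p → tgt₀ a ≡ q → T (inF F c) →
    copyOn F p c ~ copyOn F q c
  arc-on-left a refl refl refl l∈F =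
    subst₂ _~_ (cong (copyOn F (src₀ a)) (arcCell-left a l∈F))
               (cong (copyOn F (tgt₀ a)) (arcCell-left a l∈F))
      (fwd (arc a (from T-∨ (inj₁ l∈F))) ◅ ε)

  sw~se : ∀ {x y} → T (inF F (x , y)) → copyOn F (x , y) (x , y) ~ copyOn F (x + 1ℤ , y) (x , y)
  sw~se {x} {y} = arc-on-left ((x , y) , E) refl refl refl
  se~ne : ∀ {x y} → T (inF F (x , y)) → copyOn F (x + 1ℤ , y) (x , y) ~ copyOn F (x + 1ℤ , y + 1ℤ) (x , y)
  se~ne {x} {y} = arc-on-left ((x + 1ℤ , y) , N) (cong (_, y) (i+1-1≡i x)) refl refl
  ne~nw : ∀ {x y} → T (inF F (x , y)) → copyOn F (x + 1ℤ , y + 1ℤ) (x , y) ~ copyOn F (x , y + 1ℤ) (x , y)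
  ne~nw {x} {y} =
    arc-on-left ((x + 1ℤ , y + 1ℤ) , W) (cong₂ _,_ (i+1-1≡i x) (i+1-1≡i y)) refl (cong (_, y + 1ℤ) (i+1-1≡i x))

  around : ∀ {c p} → T (inF F c) → Corner c p → copyOn F c c ~ copyOn F p c
  around c∈F sw = ε
  around c∈F se = sw~se c∈F
  around c∈F ne = sw~se c∈F ◅◅ se~ne c∈F
  around c∈F nw = sw~se c∈F ◅◅ se~ne c∈F ◅◅ ne~nw c∈F

  notPinch-north : ∀ p → T (inF F (NWc p)) → T (inF F (NEc p)) → isPinch F p ≡ false
  notPinch-north p nw∈F ne∈F with inF F (SWc p) | inF F (SEc p) | inF F (NWc p) | inF F (NEc p)
  notPinch-north p () _ | _ | _ | false | _
  notPinch-north p _ () | _ | _ | true | false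
  ... | false | false | true | true = refl
  ... | false | true  | true | true = refl
  ... | true  | false | true | true = refl
  ... | true  | true  | true | true = refl

  notPinch-west : ∀ p → inF F (SWc p) ≡ false → inF F (NWc p) ≡ false → isPinch F p ≡ false
  notPinch-west p sw∉F nw∉F rewrite sw∉F | nw∉F = refl

  copyOn-notPinch : ∀ {p} c c' → isPinch F p ≡ false → copyOn F p c ≡ copyOn F p c'
  copyOn-notPinch c c' notPinch rewrite notPinch = refl

  east : ∀ {x y} → T (inF F (x , y)) → T (inF F (x + 1ℤ , y)) →
    copyOn F (x , y) (x , y) ~ copyOn F (x + 1ℤ , y) (x + 1ℤ , y)
  east {x} {y} c∈F c'∈F = subst (copyOn F (x , y) (x , y) ~_) shared (sw~se c∈F)
    where
    shared : copyOn F (x + 1ℤ , y) (x , y) ≡ copyOn F (x + 1ℤ , y) (x + 1ℤ , y)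
    shared = copyOn-notPinch (x , y) (x + 1ℤ , y)
      (notPinch-north (x + 1ℤ , y) (subst (λ z → T (inF F (z , y))) (sym (i+1-1≡i x)) c∈F) c'∈F)

  -- copyOn sees a cell only through its x-coordinate, so vertically adjacent cells share their copies.
  north : ∀ {x y} → T (inF F (x , y)) → copyOn F (x , y) (x , y) ~ copyOn F (x , y + 1ℤ) (x , y + 1ℤ)
  north c∈F = around c∈F nw

  adjacent : ∀ {c c'} → T (inF F c) → T (inF F c') → Adj4 c c' → copyOn F c c ~ copyOn F c' c'
  adjacent c∈F c'∈F (inj₁ (refl , refl)) = east c∈F c'∈F
  adjacent {x , y} c∈F c'∈F (inj₂ (inj₁ (refl , refl))) =
    symmetric _ (subst (λ z → copyOn F (x - 1ℤ , y) (x - 1ℤ , y) ~ copyOn F (z , y) (z , y)) (i-1+1≡i x)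
      (east c'∈F (subst (λ z → T (inF F (z , y))) (sym (i-1+1≡i x)) c∈F)))
  adjacent c∈F c'∈F (inj₂ (inj₂ (inj₁ (refl , refl)))) = north c∈F
  adjacent {x , y} c∈F c'∈F (inj₂ (inj₂ (inj₂ (refl , refl)))) =
    symmetric _ (subst (λ w → copyOn F (x , y - 1ℤ) (x , y - 1ℤ) ~ copyOn F (x , w) (x , w)) (i-1+1≡i y)
      (north c'∈F))

  Conn4-head : ∀ {c c'} → Conn4 F c c' → T (inF F c)
  Conn4-head (here c∈F) = c∈F
  Conn4-head (step c∈F _ _) = c∈F

  Conn4⇒Connected : ∀ {c c'} → Conn4 F c c' → copyOn F c c ~ copyOn F c' c'
  Conn4⇒Connected (here _) = ε
  Conn4⇒Connected (step c∈F adj path) = adjacent c∈F (Conn4-head path) adj ◅◅ Conn4⇒Connected path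

  cellCorners-connected : IsFigure F → ∀ {v v'} → CellCorner F v → CellCorner F v' → v ~ v'
  cellCorners-connected (_ , connected) (cellCorner c∈F corner refl) (cellCorner c'∈F corner' refl) =
    symmetric _ (around c∈F corner) ◅◅ Conn4⇒Connected (connected _ _ c∈F c'∈F) ◅◅ around c'∈F corner'

  copy-west : ∀ {x y} c → proj₁ c ≡ x - 1ℤ → ((x , y) , false) ≡ copyOn F (x , y) c
  copy-west {x} {y} c refl rewrite i-1==ℤi x = cong ((x , y) ,_) (sym (∧-zeroʳ (isPinch F (x , y))))

  copy-east : ∀ {x y b} c → proj₁ c ≡ x → isPinch F (x , y) ≡ b → ((x , y) , b) ≡ copyOn F (x , y) c
  copy-east {x} {y} c refl refl rewrite ==ℤ-refl x = cong ((x , y) ,_) (sym (∧-identityʳ (isPinch F (x , y))))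

  pinch-eastCell : ∀ p → T (isPinch F p) → T (inF F (NEc p)) ⊎ T (inF F (SEc p))
  pinch-eastCell p pinch with inF F (SWc p) | inF F (NWc p) | inF F (NEc p) | inF F (SEc p)
  ... | _     | _     | true  | _     = inj₁ _
  ... | _     | _     | false | true  = inj₂ _
  ... | false | false | false | false = ⊥-elim pinch
  ... | false | true  | false | false = ⊥-elim pinch
  ... | true  | false | false | false = ⊥-elim pinch
  ... | true  | true  | false | false = ⊥-elim pinch

  -- The copy tagged false of a pinch point lies on its western cell, so western cells are tried first.
  vertex-cellCorner : ∀ v → T (isVertex F v) → CellCorner F v
  vertex-cellCorner ((x , y) , false) v∈F
    with inF F (x - 1ℤ , y - 1ℤ) in sw∈F | inF F (x - 1ℤ , y) in nw∈F
  ... | true | _ = cellCorner (from T-≡ sw∈F) (ne-of-southwest x y) (copy-west (x - 1ℤ , y - 1ℤ) refl)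
  ... | false | true = cellCorner (from T-≡ nw∈F) (se-of-west x y) (copy-west (x - 1ℤ , y) refl)
  ... | false | false with inF F (x , y - 1ℤ) in se∈F
  ...   | true  = cellCorner (from T-≡ se∈F) (nw-of-south x y) (copy-east (x , y - 1ℤ) refl notPinch)
    where
    notPinch : isPinch F (x , y) ≡ false
    notPinch = notPinch-west (x , y) sw∈F nw∈F
  ...   | false = cellCorner v∈F sw (copy-east (x , y) refl (notPinch-west (x , y) sw∈F nw∈F))
  vertex-cellCorner ((x , y) , true) pinch with pinch-eastCell (x , y) pinch
  ... | inj₁ ne∈F = cellCorner ne∈F sw (copy-east (x , y) refl (to T-≡ pinch))
  ... | inj₂ se∈F = cellCorner se∈F (nw-of-south x y) (copy-east (x , y - 1ℤ) refl (to T-≡ pinch))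

  leftCorner : ∀ x y d → Corner (leftCell ((x , y) , d)) (x , y)
  leftCorner x y E = sw
  leftCorner x y N = se-of-west x y
  leftCorner x y W = ne-of-southwest x y
  leftCorner x y S = nw-of-south x y

  rightCorner : ∀ x y d → Corner (rightCell ((x , y) , d)) (x , y)
  rightCorner x y E = nw-of-south x y
  rightCorner x y N = sw
  rightCorner x y W = se-of-west x y
  rightCorner x y S = ne-of-southwest x y

  src-cellCorner : ∀ a → T (isArc F a) → CellCorner F (src F a)
  src-cellCorner a@((x , y) , d) a∈F with inF F (leftCell a) in l∈F
  ... | true = cellCorner (from T-≡ l∈F) (leftCorner x y d) refl
  ... | false = cellCorner a∈F (rightCorner x y d) refl

≡-mod-along : ∀ {F m} {h h' : Vtx → ℤ} → (∀ a → T (isArc F a) → D h F a ≡ D h' F a [mod m ]) →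
  ∀ {u v} → Connected F u v → h u ≡ h' u [mod m ] → h v ≡ h' v [mod m ]
≡-mod-along D≡D' ε h≡h' = h≡h'
≡-mod-along {F} {h = h} {h'} D≡D' (fwd (arc a a∈F) ◅ path) h≡h' =
  ≡-mod-along D≡D' path
    (subst₂ _≡_[mod _ ] (sym (i≡j+[i-j] (h t) (h s))) (sym (i≡j+[i-j] (h' t) (h' s))) (+-cong-mod h≡h' (D≡D' a a∈F)))
  where
  s t : Vtx
  s = src F a
  t = tgt F a
≡-mod-along {F} {h = h} {h'} D≡D' (bwd (arc a a∈F) ◅ path) h≡h' =
  ≡-mod-along D≡D' path
    (subst₂ _≡_[mod _ ] (i-[i-j]≡j (h t) (h s)) (i-[i-j]≡j (h' t) (h' s)) (−-cong-mod h≡h' (D≡D' a a∈F)))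
  where
  s t : Vtx
  s = src F a
  t = tgt F a
  i-[i-j]≡j : ∀ i j → i - (i - j) ≡ j
  i-[i-j]≡j = solve-∀

axis-separates : ∀ d a → axis d ≡ edgeOf a →
  (leftCell a ≡ cell₁ d × rightCell a ≡ cell₂ d) ⊎ (leftCell a ≡ cell₂ d × rightCell a ≡ cell₁ d)
axis-separates ((x , y) , true)  (_ , E) ()
axis-separates ((x , y) , true)  (_ , W) ()
axis-separates ((x , y) , false) (_ , N) ()
axis-separates ((x , y) , false) (_ , S) ()
axis-separates ((x , y) , true)  (_ , N) refl = inj₁ (cong (_, y) (i+1-1≡i x) , refl)
axis-separates ((x , y) , true)  (_ , S) refl = inj₂ (refl , cong (_, y) (i+1-1≡i x))
axis-separates ((x , y) , false) (_ , E) refl = inj₂ (refl , cong (x ,_) (i+1-1≡i y))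
axis-separates ((_ , y) , false) ((px , _) , W) refl = inj₁ (cong (px - 1ℤ ,_) (i+1-1≡i y) , refl)

∈⟨,⟩-retarget : ∀ {e b c c'} → c ≡ c' → e ∈⟨ b , c ⟩ → e ∈⟨ b , c' ⟩
∈⟨,⟩-retarget c≡c' = Data.Sum.map₂ (λ e≡c → trans e≡c c≡c')

∈⟨,⟩-collapse : ∀ {e b c} → c ≡ b → e ∈⟨ b , c ⟩ → e ≡ b
∈⟨,⟩-collapse c≡b (inj₁ e≡b) = e≡b
∈⟨,⟩-collapse c≡b (inj₂ e≡c) = trans e≡c c≡b

g-interior : ∀ e s c → s ∈⟨ 1ℤ , -1ℤ ⟩ → c ∈⟨ 0ℤ , 1ℤ ⟩ →
  e - s + + 2 * s * (1ℤ - + 2 * c) ∈⟨ e - s - + 2 , e - s + + 2 ⟩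
g-interior e s c (inj₁ refl) (inj₁ refl) = inj₂ refl
g-interior e s c (inj₁ refl) (inj₂ refl) = inj₁ refl
g-interior e s c (inj₂ refl) (inj₁ refl) = inj₁ refl
g-interior e s c (inj₂ refl) (inj₂ refl) = inj₂ refl

g-boundary : ∀ e s → e - s + + 2 * s * (1ℤ - + 2 * 0ℤ) ≡ e + s
g-boundary = solve-∀

sp-cases : ∀ a → sp a ∈⟨ 1ℤ , -1ℤ ⟩
sp-cases a with isWhite (leftCell a)
... | true  = inj₁ refl
... | false = inj₂ refl

χ-cases : ∀ Tl a → χ Tl a ∈⟨ 0ℤ , 1ℤ ⟩
χ-cases Tl a with any (λ d → axis d ==e edgeOf a) Tl
... | true  = inj₂ refl
... | false = inj₁ refl

module HeightFunctions
  (F : Figure) (eq : Arc → ℤ) (w0 : Vtx) (isF : IsFigure F) (w0∈V : T (isVertex F w0))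
  where

  connected-to-w0 : ∀ {v} → CellCorner F v → Connected F w0 v
  connected-to-w0 = cellCorners-connected F isF (vertex-cellCorner F w0 w0∈V)

  tt-cases : ∀ a → tt F eq a ≡ bb F eq a + + 4 ⊎ tt F eq a ≡ bb F eq a
  tt-cases a with isInterior F a
  ... | true  = inj₁ (i+2≡[i-2]+4 (eq a - sp a))
    where
    i+2≡[i-2]+4 : ∀ i → i + + 2 ≡ (i - + 2) + + 4
    i+2≡[i-2]+4 = solve-∀
  ... | false = inj₂ refl

  arc-≡-mod-4 : ∀ {h} a → D h F a ∈⟨ bb F eq a , tt F eq a ⟩ → D h F a ≡ bb F eq a [mod 4 ]
  arc-≡-mod-4 a Dh∈ with tt-cases a
  ... | inj₁ tt≡bb+4 = ∈⟨,+⟩⇒≡-mod (∈⟨,⟩-retarget tt≡bb+4 Dh∈)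
  ... | inj₂ tt≡bb   = ≡-mod-reflexive (∈⟨,⟩-collapse tt≡bb Dh∈)

  heights-≡-mod-4 : ∀ {h h'} → InH F eq w0 h → InH F eq w0 h' →
    ∀ {v} → CellCorner F v → h v ≡ h' v [mod 4 ]
  heights-≡-mod-4 {h} {h'} (h0 , Dh) (h'0 , Dh') v∈ =
    ≡-mod-along D≡D' (connected-to-w0 v∈) (≡-mod-reflexive (trans h0 (sym h'0)))
    where
    D≡D' : ∀ a → T (isArc F a) → D h F a ≡ D h' F a [mod 4 ]
    D≡D' a a∈F = ≡-mod-trans (arc-≡-mod-4 {h} a (Dh a a∈F)) (≡-mod-sym (arc-≡-mod-4 {h'} a (Dh' a a∈F)))

  InH-closed : ∀ {_∙_} → IsTranslationEquivariantSelection _∙_ →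
    ∀ h h' → InH F eq w0 h → InH F eq w0 h' → InH F eq w0 (λ v → h v ∙ h' v)
  InH-closed {_∙_} isTES h h' H@(h0 , Dh) H'@(h'0 , Dh') = base , arcs
    where
    open TranslationEquivariantSelection isTES
    base : h w0 ∙ h' w0 ≡ 0ℤ
    base = trans (cong₂ _∙_ h0 h'0) (sel⇒idem _≡_ ∙-sel 0ℤ)
    arcs : ∀ a → T (isArc F a) → D (λ v → h v ∙ h' v) F a ∈⟨ bb F eq a , tt F eq a ⟩
    arcs a a∈F with tt-cases a
    ... | inj₁ tt≡bb+4 = ∈⟨,⟩-retarget (sym tt≡bb+4)
            (∙-step (heights-≡-mod-4 H H' (src-cellCorner F a a∈F))
                    (∈⟨,⟩-retarget tt≡bb+4 (Dh a a∈F)) (∈⟨,⟩-retarget tt≡bb+4 (Dh' a a∈F)))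
    ... | inj₂ tt≡bb =
      inj₁ (∙-translate (∈⟨,⟩-collapse tt≡bb (Dh a a∈F)) (∈⟨,⟩-collapse tt≡bb (Dh' a a∈F)))

  χ-boundary : ∀ {Tl} → IsTiling F Tl → ∀ a → isInterior F a ≡ false → χ Tl a ≡ 0ℤ
  χ-boundary {Tl} (inside , _) a boundary with any (λ d → axis d ==e edgeOf a) Tl in axis∈Tl
  ... | false = refl
  ... | true with find (any⁻ _ Tl (from T-≡ axis∈Tl))
  ...   | d , d∈Tl , axis==edge
    with inside d (any⁺ _ (lose d∈Tl (from T-∧ (==c-refl (cell₁ d) , ==c-refl (cell₂ d)))))
  ...     | c₁∈F , c₂∈F = ⊥-elim (subst T boundary (interior (axis-separates d a (==e-sound axis==edge))))
    where
    ∈F-resp : ∀ {c c'} → c ≡ c' → T (inF F c) → T (inF F c')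
    ∈F-resp c≡c' = subst (λ c → T (inF F c)) c≡c'
    interior : (leftCell a ≡ cell₁ d × rightCell a ≡ cell₂ d) ⊎
               (leftCell a ≡ cell₂ d × rightCell a ≡ cell₁ d) → T (isInterior F a)
    interior (inj₁ (l≡c₁ , r≡c₂)) = from T-∧ (∈F-resp (sym l≡c₁) c₁∈F , ∈F-resp (sym r≡c₂) c₂∈F)
    interior (inj₂ (l≡c₂ , r≡c₁)) = from T-∧ (∈F-resp (sym l≡c₂) c₂∈F , ∈F-resp (sym r≡c₁) c₁∈F)

  g-∈ : ∀ {Tl} → IsTiling F Tl → ∀ a → g eq Tl a ∈⟨ bb F eq a , tt F eq a ⟩
  g-∈ {Tl} tiling a with isInterior F a in int
  ... | true  = g-interior (eq a) (sp a) (χ Tl a) (sp-cases a) (χ-cases Tl a)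
  ... | false = inj₁ (begin
    eq a - sp a + + 2 * sp a * (1ℤ - + 2 * χ Tl a) ≡⟨ cong (λ c → eq a - sp a + + 2 * sp a * (1ℤ - + 2 * c))
                                                            (χ-boundary {Tl} tiling a int) ⟩
    eq a - sp a + + 2 * sp a * (1ℤ - + 2 * 0ℤ)     ≡⟨ g-boundary (eq a) (sp a) ⟩
    eq a + sp a                                    ∎)
    where open ≡-Reasoning

  heightOf-InH : ∀ Tl h → IsTiling F Tl → IsHeightOf F eq w0 Tl h → InH F eq w0 h
  heightOf-InH Tl h tiling (h0 , Dh) =
    h0 , λ a a∈F → Data.Sum.map (trans (Dh a a∈F)) (trans (Dh a a∈F)) (g-∈ {Tl} tiling a)

  heightOf-unique : ∀ Tl h h' → IsHeightOf F eq w0 Tl h → IsHeightOf F eq w0 Tl h' →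
    ∀ v → T (isVertex F v) → h v ≡ h' v
  heightOf-unique Tl h h' (h0 , Dh) (h'0 , Dh') v v∈V = ≡-mod-0⇒≡
    (≡-mod-along (λ a a∈F → ≡-mod-reflexive (trans (Dh a a∈F) (sym (Dh' a a∈F))))
      (connected-to-w0 (vertex-cellCorner F v v∈V)) (≡-mod-reflexive (trans h0 (sym h'0))))

  H-isDistributiveLattice : HDistributiveLattice F eq w0
  H-isDistributiveLattice = combine ⊔-isTranslationEquivariantSelection , combine ⊓-isTranslationEquivariantSelection ,
    pointwise-isDistributiveLattice (λ v → T (isVertex F v)) proj₁ (mk⇔ id id) (mk⇔ id id)
      (λ _ _ _ _ → refl) (λ _ _ _ _ → refl)
    where
    combine : ∀ {_∙_} → IsTranslationEquivariantSelection _∙_ → HF F eq w0 → HF F eq w0 → HF F eq w0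
    combine {_∙_} isTES (h , H) (h' , H') = (λ v → h v ∙ h' v) , InH-closed isTES h h' H H'

  tilings-isDistributiveLattice : HeightBijection F eq w0 → TilingDistributiveLattice F eq w0
  tilings-isDistributiveLattice (heightOf , tilingOf) =
    combine ⊔-isTranslationEquivariantSelection , combine ⊓-isTranslationEquivariantSelection ,
    pointwise-isDistributiveLattice (λ v → T (isVertex F v)) φ
      (mk⇔ (λ x≈y → x≈y _ _ (φ-height _) (φ-height _))
           (via-φ λ a≡b b≡c c≡d → trans a≡b (trans b≡c c≡d)))
      (mk⇔ (λ x≤y → x≤y _ _ (φ-height _) (φ-height _))
           (via-φ λ a≡b b≤c c≡d → subst₂ _≤_ (sym a≡b) c≡d b≤c))
      (λ _ _ → φ-tilingOf _ _) (λ _ _ → φ-tilingOf _ _)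
    where
    φ : Tiling F → Vtx → ℤ
    φ Tl = proj₁ (heightOf Tl)
    φ-height : ∀ Tl → IsHeightOf F eq w0 (proj₁ Tl) (φ Tl)
    φ-height Tl = proj₂ (heightOf Tl)
    φ-InH : ∀ Tl → InH F eq w0 (φ Tl)
    φ-InH Tl = heightOf-InH (proj₁ Tl) (φ Tl) (proj₂ Tl) (φ-height Tl)
    tiling : ∀ h → InH F eq w0 h → Tiling F
    tiling h H = proj₁ (tilingOf h H)
    φ-tilingOf : ∀ h H v → T (isVertex F v) → φ (tiling h H) v ≡ h v
    φ-tilingOf h H =
      heightOf-unique (proj₁ (tiling h H)) (φ (tiling h H)) h (φ-height (tiling h H)) (proj₂ (tilingOf h H))
    combine : ∀ {_∙_} → IsTranslationEquivariantSelection _∙_ → Tiling F → Tiling F → Tiling F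
    combine {_∙_} isTES x y = tiling (λ v → φ x v ∙ φ y v) (InH-closed isTES (φ x) (φ y) (φ-InH x) (φ-InH y))
    via-φ : ∀ {_R_ : ℤ → ℤ → Set} → (∀ {a b c d} → a ≡ b → b R c → c ≡ d → a R d) →
      ∀ {x y : Tiling F} → (∀ v → T (isVertex F v) → φ x v R φ y v) →
      ∀ h h' → IsHeightOf F eq w0 (proj₁ x) h → IsHeightOf F eq w0 (proj₁ y) h' →
      ∀ v → T (isVertex F v) → h v R h' v
    via-φ resp {x} {y} φxRφy h h' Hh Hh' v v∈V =
      resp (heightOf-unique (proj₁ x) h (φ x) Hh (φ-height x) v v∈V) (φxRφy v v∈V)
        (heightOf-unique (proj₁ y) (φ y) h' (φ-height y) Hh' v v∈V)

mainTheorem4 : (F : Figure) → IsFigure F →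
    (eq : Arc → ℤ) → IsEquilibrium F eq →
    (w0 : Vtx) → OnBoundaryHinf F w0 →
    ((h h' : Vtx → ℤ) → InH F eq w0 h → InH F eq w0 h' →
       InH F eq w0 (λ v → h v ⊓ h' v) × InH F eq w0 (λ v → h v ⊔ h' v))
    × HDistributiveLattice F eq w0
    × (HeightBijection F eq w0 → TilingDistributiveLattice F eq w0)
mainTheorem4 F isF eq _ w0 (w0∈V , _) =
  (λ h h' H H' → InH-closed ⊓-isTranslationEquivariantSelection h h' H H' ,
                 InH-closed ⊔-isTranslationEquivariantSelection h h' H H') ,
  H-isDistributiveLattice ,
  tilings-isDistributiveLattice
  where open HeightFunctions F eq w0 isF w0∈V
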